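{- Let $p$ be a prime, let $m$ be a positive integer divisible by $3$, let $n=\frac m3(p-1)$ and $U=[0,n]^2$. Let $i$ be an integer with $0\le i\le n$, let $J_0,\dots,J_{i-1}$ be a forward consistent sequence of ideals of $U$, and let $J_i$ be an ideal of $U$. Then $J_i$ is consistent with $J_0,\dots,J_{i-1}$ if and only if the following conditions hold: (i) $J_i\subseteq J_{i-1}$; (ii) $J_i\supseteq\bigl[J_{i-1}+D-(0,p)\bigr]\cap U$; (iii) $\bigl[J_i+D+(1,0)\bigr]\cap U\subseteq J_{i-p}$ (void if $i-p<0$); (iv) if there exists an integer $\beta$ with $1\le\beta\le p-1$, $i-\beta\ge 0$ and $J_{i-\beta}\ne U$, then, letting $\beta_i$ be the largest such integer, $\bigl[J_i+D+(1,-p^2+p\beta_i)\bigr]\cap U\subseteq J_{i-\beta_i}$ (if no such $\beta$ exists, this condition is void).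
   Context: $D=\{(x,y)\in\mathbb{R}^2: x+py\le 0,\ p^2x+y\le 0\}$ and $\Delta=\{(x,y,z)\in\mathbb{R}^3: x+py+p^2z\le 0,\ p^2x+y+pz\le 0,\ px+p^2y+z\le 0\}$. For $u,v\in\mathbb{R}^2$, $u\prec v$ means $u\in v+D$; for $u,v\in\mathbb{R}^3$, $u\prec v$ means $u\in v+\Delta$. For $\Omega\subseteq\mathbb{R}^2$ or $\mathbb{R}^3$, an ideal of $\Omega$ is a subset $I\subseteq\Omega$ such that $u\in I$, $v\in\Omega$, $v\prec u$ imply $v\in I$. For integers $a\le b$, $[a,b]=\{x\in\mathbb{Z}:a\le x\le b\}$. Sums like $J+D+(a,b)$ are Minkowski sums in $\mathbb{R}^2$. A sequence $J_0,\dots,J_{i-1}$ of ideals of $U$ is forward consistent if $\bigcup_{j=0}^{i-1}(J_j\times\{j\})$ is an ideal of $U\times[0,i-1]$ (with respect to $\prec$ on $\mathbb{R}^3$); $J_i$ is consistent with $J_0,\dots,J_{i-1}$ if $J_0,\dots,J_{i-1},J_i$ is forward consistent. -}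

module Defs where

open import Level using (0ℓ)
open import Data.Bool using (Bool; true)
open import Data.Nat as ℕ using (ℕ; suc; _∸_; _/_)
open import Data.Integer as ℤ using (ℤ; +_; _+_; _-_; _*_; -_; 0ℤ; 1ℤ)
open import Data.Product using (_×_; _,_; ∃)
open import Relation.Binary.PropositionalEquality using (_≡_)
open import Relation.Nullary using (¬_)
open import Relation.Unary using (Pred; _∈_; _⊆_; _∩_; _≐_)

Point2 : Set
Point2 = ℤ × ℤ

Point3 : Set
Point3 = ℤ × ℤ × ℤ

Subset2 : Set
Subset2 = Point2 → Bool

⟦_⟧ : Subset2 → Pred Point2 0ℓ
⟦ S ⟧ w = S w ≡ true

D : ℕ → Pred Point2 0ℓ
D p (x , y) = (x + (+ p) * y ℤ.≤ 0ℤ) × ((+ p) * (+ p) * x + y ℤ.≤ 0ℤ)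

Δ : ℕ → Pred Point3 0ℓ
Δ p (x , y , z) =
  (x + (+ p) * y + (+ p) * (+ p) * z ℤ.≤ 0ℤ) ×
  ((+ p) * (+ p) * x + y + (+ p) * z ℤ.≤ 0ℤ) ×
  ((+ p) * x + (+ p) * (+ p) * y + z ℤ.≤ 0ℤ)

_≺₂[_]_ : Point2 → ℕ → Point2 → Set
(a , b) ≺₂[ p ] (c , d) = (a - c , b - d) ∈ D p

_≺₃[_]_ : Point3 → ℕ → Point3 → Set
(a , b , c) ≺₃[ p ] (d , e , f) = (a - d , b - e , c - f) ∈ Δ p

IsIdeal : {A : Set} → (A → A → Set) → Pred A 0ℓ → Pred A 0ℓ → Set
IsIdeal _≺_ Ω I = (I ⊆ Ω) × (∀ {u v} → u ∈ I → v ∈ Ω → v ≺ u → v ∈ I)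

Interval : ℤ → ℤ → Pred ℤ 0ℓ
Interval a b x = (a ℤ.≤ x) × (x ℤ.≤ b)

Box : ℕ → Pred Point2 0ℓ
Box n (x , y) = Interval 0ℤ (+ n) x × Interval 0ℤ (+ n) y

Prism : ℕ → ℕ → Pred Point3 0ℓ
Prism n i (x , y , z) = Box n (x , y) × Interval 0ℤ ((+ i) - 1ℤ) z

Stack : (ℕ → Subset2) → ℕ → Pred Point3 0ℓ
Stack J i (x , y , z) = ∃ λ j → (j ℕ.< i) × (z ≡ + j) × ((x , y) ∈ ⟦ J j ⟧)

ForwardConsistent : ℕ → ℕ → (ℕ → Subset2) → ℕ → Set
ForwardConsistent p n J i = IsIdeal (λ u v → u ≺₃[ p ] v) (Prism n i) (Stack J i)

ConsistentWith : ℕ → ℕ → (ℕ → Subset2) → ℕ → Set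
ConsistentWith p n J i = ForwardConsistent p n J (suc i)

PlusD : ℕ → Subset2 → Point2 → Pred Point2 0ℓ
PlusD p S (a , b) (x , y) =
  ∃ λ s → (s ∈ ⟦ S ⟧) × ((x - Data.Product.proj₁ s - a , y - Data.Product.proj₂ s - b) ∈ D p)

nOf : ℕ → ℕ → ℕ
nOf m p = (m / 3) ℕ.* (p ∸ 1)

GoodBeta : ℕ → ℕ → (ℕ → Subset2) → ℕ → ℕ → Set
GoodBeta p n J i β =
  (1 ℕ.≤ β) × (β ℕ.≤ p ∸ 1) × (β ℕ.≤ i) × ¬ (⟦ J (i ∸ β) ⟧ ≐ Box n)

IsLargestGoodBeta : ℕ → ℕ → (ℕ → Subset2) → ℕ → ℕ → Set
IsLargestGoodBeta p n J i β =
  GoodBeta p n J i β × (∀ β′ → GoodBeta p n J i β′ → β′ ℕ.≤ β)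

CondI CondII CondIII CondIV Conditions : ℕ → ℕ → (ℕ → Subset2) → ℕ → Set
CondI p n J i = ∀ k → i ≡ suc k → ⟦ J i ⟧ ⊆ ⟦ J k ⟧
CondII p n J i = ∀ k → i ≡ suc k → (PlusD p (J k) (0ℤ , - (+ p)) ∩ Box n) ⊆ ⟦ J i ⟧
CondIII p n J i = p ℕ.≤ i → (PlusD p (J i) (1ℤ , 0ℤ) ∩ Box n) ⊆ ⟦ J (i ∸ p) ⟧
CondIV p n J i = ∀ β → IsLargestGoodBeta p n J i β →
  (PlusD p (J i) (1ℤ , - ((+ p) * (+ p)) + (+ p) * (+ β)) ∩ Box n) ⊆ ⟦ J (i ∸ β) ⟧
Conditions p n J i = CondI p n J i × CondII p n J i × CondIII p n J i × CondIV p n J i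

-- Write (w, l) ≺ (a, j) for (w - a, l - j) ∈ Δ.  Closedness of the stack up to level i
-- splits according to the levels involved.  Pairs below level i are covered by forward
-- consistency, pairs inside level i by J_i being an ideal (the slice z = 0 of Δ is D),
-- and each condition is a single instance of closedness, which gives the forward
-- direction.  Conversely, (w, i) ≺ (a, j) with j < i is reduced to (ii) by raising w to
-- a point of J_{i-1}: w + (0, p), or w + (p², 0) at the top of the box.  A pair
-- (w, l) ≺ (a, i) is routed through an earlier level: if i - l ≥ p through
-- a + (1, 0) or a + (1 - p, 1) ∈ J_{i-p}, given by (iii); if i - l < p through
-- a ∈ J_{i-1} when w₁ ≤ a₁, and otherwise through a + (1, -p² + pβᵢ) ∈ J_{i-βᵢ},
-- given by (iv), where βᵢ ≥ i - l because w ∉ J_l makes i - l admissible.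
module Submission where

open import Level using (0ℓ)
open import Data.Bool using (true)
import Data.Bool.Properties as Bool
open import Data.Empty using (⊥-elim)
open import Data.Integer as ℤ using (ℤ; +_; +≤+; +<+; 0ℤ; 1ℤ; -_; _+_; _-_; _*_)
import Data.Integer.Properties as ℤ
open import Data.Integer.Tactic.RingSolver using (solve)
open import Data.List using ([]; _∷_)
open import Data.Nat as ℕ using (ℕ; zero; suc; _∸_; _≤_; _<_; z≤n; s≤s; NonZero)
import Data.Nat.Properties as ℕ
open import Data.Nat.Divisibility using (_∣_)
open import Data.Nat.Primality using (Prime; prime⇒nonZero)
open import Data.Product using (∃; _×_; _,_; proj₁; proj₂)
open import Data.Sum using (_⊎_; inj₁; inj₂; [_,_]′)
open import Function.Base using (_∘_)
open import Function.Bundles using (_⇔_; mk⇔; Equivalence)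
open import Relation.Binary.PropositionalEquality using (_≡_; refl; sym; trans; cong; subst)
open import Relation.Nullary using (¬_; Dec; yes; no)
open import Relation.Nullary.Decidable using (decidable-stable)
open import Relation.Unary using (Pred; _∈_; _⊆_)

open import Defs

infixl 6 _⊕_

_⊕_ : ∀ {x y} → x ℤ.≤ 0ℤ → y ℤ.≤ 0ℤ → x + y ℤ.≤ 0ℤ
_⊕_ = ℤ.+-mono-≤

scale : ∀ {c x} → 0ℤ ℤ.≤ c → x ℤ.≤ 0ℤ → c * x ℤ.≤ 0ℤ
scale {c} {x} 0≤c x≤0 =
  subst (c * x ℤ.≤_) (ℤ.*-zeroʳ c) (ℤ.*-monoˡ-≤-nonNeg c {{ℤ.nonNegative 0≤c}} x≤0)

0≤* : ∀ {x y} → 0ℤ ℤ.≤ x → 0ℤ ℤ.≤ y → 0ℤ ℤ.≤ x * y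
0≤* {x} {y} 0≤x 0≤y =
  subst (ℤ._≤ x * y) (ℤ.*-zeroʳ x) (ℤ.*-monoˡ-≤-nonNeg x {{ℤ.nonNegative 0≤x}} 0≤y)

neg≤0 : ∀ {x} → 0ℤ ℤ.≤ x → - x ℤ.≤ 0ℤ
neg≤0 = ℤ.neg-mono-≤

i<j⇒1+i-j≤0 : ∀ {i j} → i ℤ.< j → (1ℤ + i) - j ℤ.≤ 0ℤ
i<j⇒1+i-j≤0 i<j = ℤ.i≤j⇒i-j≤0 (ℤ.i<j⇒suc[i]≤j i<j)

-- Every linear inequality below is obtained by exhibiting x - z as a nonnegative
-- combination of quantities already known to be nonpositive; the ring solver checks
-- the identity.
≤-by : ∀ {x y z} → y ℤ.≤ 0ℤ → x - z ≡ y → x ℤ.≤ z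
≤-by y≤0 refl = ℤ.i-j≤0⇒i≤j y≤0

i<j+1⇒i≤j : ∀ {i j} → i ℤ.< j + 1ℤ → i ℤ.≤ j
i<j+1⇒i≤j {i} {j} i<j+1 = ≤-by (i<j⇒1+i-j≤0 i<j+1) (solve (i ∷ j ∷ []))

1+i≰i : ∀ {i} → ¬ (1ℤ + i ℤ.≤ i)
1+i≰i 1+i≤i = ℤ.<-irrefl refl (ℤ.suc[i]≤j⇒i<j 1+i≤i)

-- Keeping P and N
-- variables lets the ring solver treat them as indeterminates.
D⟨_⟩ : ℤ → Pred Point2 0ℓ
D⟨ P ⟩ (x , y) = (x + P * y ℤ.≤ 0ℤ) × (P * P * x + y ℤ.≤ 0ℤ)

Δ⟨_⟩ : ℤ → Pred Point3 0ℓ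
Δ⟨ P ⟩ (x , y , z) =
  (x + P * y + P * P * z ℤ.≤ 0ℤ) × (P * P * x + y + P * z ℤ.≤ 0ℤ) × (P * x + P * P * y + z ℤ.≤ 0ℤ)

Box⟨_⟩ : ℤ → Pred Point2 0ℓ
Box⟨ N ⟩ (x , y) = Interval 0ℤ N x × Interval 0ℤ N y

_≺⟨_⟩_ : Point3 → ℤ → Point3 → Set
(a , b , c) ≺⟨ P ⟩ (d , e , f) = (a - d , b - e , c - f) ∈ Δ⟨ P ⟩

module Cone (P : ℤ) (1≤P : 1ℤ ℤ.≤ P) where

  private
    0≤1 : 0ℤ ℤ.≤ 1ℤ
    0≤1 = +≤+ z≤n

    0≤P : 0ℤ ℤ.≤ P
    0≤P = ℤ.≤-trans 0≤1 1≤P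

    0≤P² : 0ℤ ℤ.≤ P * P
    0≤P² = 0≤* 0≤P 0≤P

    1-P≤0 : 1ℤ - P ℤ.≤ 0ℤ
    1-P≤0 = ℤ.i≤j⇒i-j≤0 1≤P

    0≤P³-1 : 0ℤ ℤ.≤ P * P * P - 1ℤ
    0≤P³-1 = ≤-by (neg≤0 (0≤* 0≤P-1 0≤P²+P+1)) (solve (P ∷ []))
      where
      0≤P-1 : 0ℤ ℤ.≤ P - 1ℤ
      0≤P-1 = ℤ.i≤j⇒0≤j-i 1≤P
      0≤P²+P+1 : 0ℤ ℤ.≤ P * P + P + 1ℤ
      0≤P²+P+1 = ℤ.+-mono-≤ (ℤ.+-mono-≤ 0≤P² 0≤P) 0≤1

    cancel-P : ∀ {x} → P * x ℤ.≤ 0ℤ → x ℤ.≤ 0ℤ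
    cancel-P {x} Px≤0 = ℤ.*-cancelˡ-≤-pos x 0ℤ P {{ℤ.positive (ℤ.suc[i]≤j⇒i<j 1≤P)}}
      (subst (P * x ℤ.≤_) (sym (ℤ.*-zeroʳ P)) Px≤0)

    P*x<P⇒x≤0 : ∀ {x} → P * x + 1ℤ - P ℤ.≤ 0ℤ → x ℤ.≤ 0ℤ
    P*x<P⇒x≤0 {x} h = decide (x ℤ.≤? 0ℤ)
      where
      decide : Dec (x ℤ.≤ 0ℤ) → x ℤ.≤ 0ℤ
      decide (yes x≤0) = x≤0
      decide (no x≰0) = ⊥-elim (1+i≰i {x} (≤-by (h ⊕ scale 0≤P (i<j⇒1+i-j≤0 (ℤ.≰⇒> x≰0))) (solve (P ∷ x ∷ []))))

  ≺-same-level⇒D : ∀ w₁ w₂ a₁ a₂ K →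
    (w₁ , w₂ , K) ≺⟨ P ⟩ (a₁ , a₂ , K) → (w₁ - a₁ , w₂ - a₂) ∈ D⟨ P ⟩
  ≺-same-level⇒D w₁ w₂ a₁ a₂ K (hA , hB , _) =
    ≤-by hA (solve (P ∷ w₁ ∷ w₂ ∷ a₁ ∷ a₂ ∷ K ∷ [])) ,
    ≤-by hB (solve (P ∷ w₁ ∷ w₂ ∷ a₁ ∷ a₂ ∷ K ∷ []))

  ≺-pred-level : ∀ a₁ a₂ I K → I ≡ 1ℤ + K → (a₁ , a₂ , K) ≺⟨ P ⟩ (a₁ , a₂ , I)
  ≺-pred-level a₁ a₂ _ K refl =
    ≤-by (neg≤0 0≤P²) (solve (P ∷ a₁ ∷ a₂ ∷ K ∷ [])) ,
    ≤-by (neg≤0 0≤P) (solve (P ∷ a₁ ∷ a₂ ∷ K ∷ [])) ,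
    ≤-by (neg≤0 0≤1) (solve (P ∷ a₁ ∷ a₂ ∷ K ∷ []))

  ≺-up⇔D : ∀ w₁ w₂ s₁ s₂ I K → I ≡ 1ℤ + K →
    (w₁ , w₂ , I) ≺⟨ P ⟩ (s₁ , s₂ , K) ⇔ (w₁ - s₁ - 0ℤ , w₂ - s₂ - - P) ∈ D⟨ P ⟩
  ≺-up⇔D w₁ w₂ s₁ s₂ _ K refl = mk⇔
    (λ (hA , hB , _) →
      ≤-by hA (solve (P ∷ w₁ ∷ w₂ ∷ s₁ ∷ s₂ ∷ K ∷ [])) ,
      ≤-by hB (solve (P ∷ w₁ ∷ w₂ ∷ s₁ ∷ s₂ ∷ K ∷ [])))
    (λ (h₁ , h₂) →
      ≤-by h₁ (solve (P ∷ w₁ ∷ w₂ ∷ s₁ ∷ s₂ ∷ K ∷ [])) ,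
      ≤-by h₂ (solve (P ∷ w₁ ∷ w₂ ∷ s₁ ∷ s₂ ∷ K ∷ [])) ,
      ≤-by (scale 0≤P h₁ ⊕ neg≤0 0≤P³-1) (solve (P ∷ w₁ ∷ w₂ ∷ s₁ ∷ s₂ ∷ K ∷ [])))

  ≺-down⇐D : ∀ w₁ w₂ s₁ s₂ I K B c → I ≡ K + B → c ≡ - (P * P) + P * B → B ℤ.≤ P →
    (w₁ - s₁ - 1ℤ , w₂ - s₂ - c) ∈ D⟨ P ⟩ → (w₁ , w₂ , K) ≺⟨ P ⟩ (s₁ , s₂ , I)
  ≺-down⇐D w₁ w₂ s₁ s₂ _ K B _ refl refl B≤P (h₁ , h₂) =
    ≤-by (h₁ ⊕ neg≤0 0≤P³-1) (solve (P ∷ w₁ ∷ w₂ ∷ s₁ ∷ s₂ ∷ K ∷ B ∷ [])) ,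
    ≤-by h₂ (solve (P ∷ w₁ ∷ w₂ ∷ s₁ ∷ s₂ ∷ K ∷ B ∷ [])) ,
    ≤-by (scale 0≤P h₁ ⊕ neg≤0 (0≤* 0≤P³-1 (ℤ.i≤j⇒0≤j-i B≤P)))
      (solve (P ∷ w₁ ∷ w₂ ∷ s₁ ∷ s₂ ∷ K ∷ B ∷ []))

  ≺-raise-y : ∀ w₁ w₂ a₁ a₂ I I′ K → I ≡ 1ℤ + I′ → K ℤ.≤ I′ →
    (w₁ , w₂ , I) ≺⟨ P ⟩ (a₁ , a₂ , K) → (w₁ , w₂ + P , I′) ≺⟨ P ⟩ (a₁ , a₂ , K)
  ≺-raise-y w₁ w₂ a₁ a₂ _ I′ K refl K≤I′ (hA , hB , _) =
    ≤-by hA (solve (P ∷ w₁ ∷ w₂ ∷ a₁ ∷ a₂ ∷ I′ ∷ K ∷ [])) ,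
    ≤-by hB (solve (P ∷ w₁ ∷ w₂ ∷ a₁ ∷ a₂ ∷ I′ ∷ K ∷ [])) ,
    ≤-by (scale 0≤P hA ⊕ scale 0≤P³-1 (ℤ.i≤j⇒i-j≤0 K≤I′))
      (solve (P ∷ w₁ ∷ w₂ ∷ a₁ ∷ a₂ ∷ I′ ∷ K ∷ []))

  raise-y∈Box : ∀ N w₁ w₂ → (w₁ , w₂) ∈ Box⟨ N ⟩ → w₂ + P ℤ.≤ N → (w₁ , w₂ + P) ∈ Box⟨ N ⟩
  raise-y∈Box N w₁ w₂ (w₁∈[0,N] , (0≤w₂ , _)) w₂+P≤N =
    w₁∈[0,N] , (≤-by (ℤ.i≤j⇒i-j≤0 0≤w₂ ⊕ neg≤0 0≤P) (solve (P ∷ w₂ ∷ [])) , w₂+P≤N)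

  raise-y∈D : ∀ w₁ w₂ → (w₁ - w₁ - 0ℤ , w₂ - (w₂ + P) - - P) ∈ D⟨ P ⟩
  raise-y∈D w₁ w₂ =
    ≤-by ℤ.≤-refl (solve (P ∷ w₁ ∷ w₂ ∷ [])) , ≤-by ℤ.≤-refl (solve (P ∷ w₁ ∷ w₂ ∷ []))

  -- When w + (0, P) leaves the box, w + (P², 0) is used instead; the bound on its
  -- first coordinate comes from the Δ-relation itself.
  ≺-raise-x : ∀ N w₁ w₂ a₁ a₂ I I′ K → I ≡ 1ℤ + I′ → 1ℤ + K ℤ.≤ I′ → N ℤ.< w₂ + P →
    (w₁ , w₂) ∈ Box⟨ N ⟩ → (a₁ , a₂) ∈ Box⟨ N ⟩ → (w₁ , w₂ , I) ≺⟨ P ⟩ (a₁ , a₂ , K) →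
    (w₁ + P * P , w₂) ∈ Box⟨ N ⟩ × (w₁ + P * P , w₂ , I′) ≺⟨ P ⟩ (a₁ , a₂ , K)
  ≺-raise-x N w₁ w₂ a₁ a₂ _ I′ K refl K<I′ N<w₂+P ((0≤w₁ , _) , w₂∈[0,N]) ((_ , a₁≤N) , (_ , a₂≤N))
            (hA , hB , _) =
    ((≤-by (ℤ.i≤j⇒i-j≤0 0≤w₁ ⊕ neg≤0 0≤P²) (solve (P ∷ w₁ ∷ [])) ,
      ≤-by (hA ⊕ scale 0≤P (gap ⊕ scale 0≤P levels) ⊕ neg≤0 0≤P ⊕ ℤ.i≤j⇒i-j≤0 a₁≤N)
        (solve (P ∷ w₁ ∷ w₂ ∷ a₁ ∷ a₂ ∷ N ∷ I′ ∷ K ∷ []))) ,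
     w₂∈[0,N]) ,
    ≤-by hA (solve (P ∷ w₁ ∷ w₂ ∷ a₁ ∷ a₂ ∷ N ∷ I′ ∷ K ∷ [])) ,
    ≤-by (scale 0≤P² hA ⊕ scale 0≤P³-1 (gap ⊕ scale 0≤P levels) ⊕ neg≤0 0≤P³-1)
      (solve (P ∷ w₁ ∷ w₂ ∷ a₁ ∷ a₂ ∷ N ∷ I′ ∷ K ∷ [])) ,
    ≤-by (scale 0≤P hA ⊕ scale 0≤P³-1 (levels ⊕ neg≤0 0≤1))
      (solve (P ∷ w₁ ∷ w₂ ∷ a₁ ∷ a₂ ∷ N ∷ I′ ∷ K ∷ []))
    where
    gap : (1ℤ + N) - (w₂ + P) + (a₂ - N) ℤ.≤ 0ℤ
    gap = i<j⇒1+i-j≤0 N<w₂+P ⊕ ℤ.i≤j⇒i-j≤0 a₂≤N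
    levels : (1ℤ + K) - I′ ℤ.≤ 0ℤ
    levels = ℤ.i≤j⇒i-j≤0 K<I′

  raise-x∈D : ∀ w₁ w₂ → (w₁ - (w₁ + P * P) - 0ℤ , w₂ - w₂ - - P) ∈ D⟨ P ⟩
  raise-x∈D w₁ w₂ =
    ≤-by ℤ.≤-refl (solve (P ∷ w₁ ∷ w₂ ∷ [])) ,
    ≤-by (neg≤0 (0≤* 0≤P 0≤P³-1)) (solve (P ∷ w₁ ∷ w₂ ∷ []))

  ≺-of-nonpositive : ∀ w₁ w₂ a₁ a₂ L I → w₁ ℤ.≤ a₁ → w₂ ℤ.≤ a₂ → L ℤ.≤ I →
    (w₁ , w₂ , L) ≺⟨ P ⟩ (a₁ , a₂ , I)
  ≺-of-nonpositive w₁ w₂ a₁ a₂ L I w₁≤a₁ w₂≤a₂ L≤I =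
    ≤-by (x ⊕ scale 0≤P y ⊕ scale 0≤P² z) (solve (P ∷ w₁ ∷ w₂ ∷ a₁ ∷ a₂ ∷ L ∷ I ∷ [])) ,
    ≤-by (scale 0≤P² x ⊕ y ⊕ scale 0≤P z) (solve (P ∷ w₁ ∷ w₂ ∷ a₁ ∷ a₂ ∷ L ∷ I ∷ [])) ,
    ≤-by (scale 0≤P x ⊕ scale 0≤P² y ⊕ z) (solve (P ∷ w₁ ∷ w₂ ∷ a₁ ∷ a₂ ∷ L ∷ I ∷ []))
    where
    x = ℤ.i≤j⇒i-j≤0 w₁≤a₁
    y = ℤ.i≤j⇒i-j≤0 w₂≤a₂
    z = ℤ.i≤j⇒i-j≤0 L≤I

  ≺-advance-x : ∀ w₁ w₂ a₁ a₂ L I I′ → I ≡ I′ + P → L ℤ.≤ I′ →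
    (w₁ , w₂ , L) ≺⟨ P ⟩ (a₁ , a₂ , I) → (w₁ , w₂ , L) ≺⟨ P ⟩ (a₁ + 1ℤ , a₂ , I′)
  ≺-advance-x w₁ w₂ a₁ a₂ L _ I′ refl L≤I′ (_ , hB , hC) =
    cancel-P (≤-by (hC ⊕ scale 0≤P³-1 (ℤ.i≤j⇒i-j≤0 L≤I′))
      (solve (P ∷ w₁ ∷ w₂ ∷ a₁ ∷ a₂ ∷ L ∷ I′ ∷ []))) ,
    ≤-by hB (solve (P ∷ w₁ ∷ w₂ ∷ a₁ ∷ a₂ ∷ L ∷ I′ ∷ [])) ,
    ≤-by hC (solve (P ∷ w₁ ∷ w₂ ∷ a₁ ∷ a₂ ∷ L ∷ I′ ∷ []))

  advance-x∈D : ∀ a₁ a₂ → ((a₁ + 1ℤ) - a₁ - 1ℤ , a₂ - a₂ - 0ℤ) ∈ D⟨ P ⟩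
  advance-x∈D a₁ a₂ =
    ≤-by ℤ.≤-refl (solve (P ∷ a₁ ∷ a₂ ∷ [])) , ≤-by ℤ.≤-refl (solve (P ∷ a₁ ∷ a₂ ∷ []))

  ≺-advance-xy : ∀ w₁ w₂ a₁ a₂ L I I′ → I ≡ I′ + P → L ℤ.≤ I′ → a₂ ℤ.< w₂ →
    (w₁ , w₂ , L) ≺⟨ P ⟩ (a₁ , a₂ , I) → (w₁ , w₂ , L) ≺⟨ P ⟩ (a₁ + 1ℤ - P , a₂ + 1ℤ , I′)
  ≺-advance-xy w₁ w₂ a₁ a₂ L _ I′ refl L≤I′ a₂<w₂ (_ , _ , hC) =
    cancel-P (≤-by (hC ⊕ scale 0≤P³-1 (ℤ.i≤j⇒i-j≤0 L≤I′))
      (solve (P ∷ w₁ ∷ w₂ ∷ a₁ ∷ a₂ ∷ L ∷ I′ ∷ []))) ,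
    cancel-P (cancel-P (≤-by (scale (0≤* 0≤P² 0≤P) hC ⊕ scale (0≤* 0≤P² 0≤P³-1) (i<j⇒1+i-j≤0 a₂<w₂))
      (solve (P ∷ w₁ ∷ w₂ ∷ a₁ ∷ a₂ ∷ L ∷ I′ ∷ [])))) ,
    ≤-by hC (solve (P ∷ w₁ ∷ w₂ ∷ a₁ ∷ a₂ ∷ L ∷ I′ ∷ []))

  advance-xy∈D : ∀ a₁ a₂ → ((a₁ + 1ℤ - P) - a₁ - 1ℤ , (a₂ + 1ℤ) - a₂ - 0ℤ) ∈ D⟨ P ⟩
  advance-xy∈D a₁ a₂ =
    ≤-by ℤ.≤-refl (solve (P ∷ a₁ ∷ a₂ ∷ [])) ,
    ≤-by (neg≤0 0≤P³-1) (solve (P ∷ a₁ ∷ a₂ ∷ []))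

  advance-xy∈Box : ∀ N w₁ w₂ a₁ a₂ → (w₁ , w₂) ∈ Box⟨ N ⟩ → (a₁ , a₂) ∈ Box⟨ N ⟩ →
    N ℤ.< a₁ + 1ℤ → P ℤ.≤ N → a₂ ℤ.< w₂ → (a₁ + 1ℤ - P , a₂ + 1ℤ) ∈ Box⟨ N ⟩
  advance-xy∈Box N w₁ w₂ a₁ a₂ (_ , (_ , w₂≤N)) ((_ , a₁≤N) , (0≤a₂ , _)) N<a₁+1 P≤N a₂<w₂ =
    (≤-by (ℤ.i≤j⇒i-j≤0 P≤N ⊕ i<j⇒1+i-j≤0 N<a₁+1 ⊕ neg≤0 0≤1) (solve (P ∷ N ∷ a₁ ∷ [])) ,
     ≤-by (ℤ.i≤j⇒i-j≤0 a₁≤N ⊕ 1-P≤0) (solve (P ∷ N ∷ a₁ ∷ []))) ,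
    (≤-by (ℤ.i≤j⇒i-j≤0 0≤a₂ ⊕ neg≤0 0≤1) (solve (a₂ ∷ [])) ,
     ≤-by (i<j⇒1+i-j≤0 a₂<w₂ ⊕ ℤ.i≤j⇒i-j≤0 w₂≤N) (solve (N ∷ a₂ ∷ w₂ ∷ [])))

  ≺-advance-β : ∀ w₁ w₂ a₁ a₂ L I I′ B → I ≡ I′ + B → a₁ ℤ.< w₁ → I ℤ.≤ B + L →
    (w₁ , w₂ , L) ≺⟨ P ⟩ (a₁ , a₂ , I) →
    (w₁ , w₂ , L) ≺⟨ P ⟩ (a₁ + 1ℤ , a₂ + (- (P * P) + P * B) , I′)
  ≺-advance-β w₁ w₂ a₁ a₂ L _ I′ B refl a₁<w₁ I≤B+L (_ , hB , _) =
    ≤-by (scale 0≤P hB ⊕ scale 0≤P³-1 x>0) (solve (P ∷ w₁ ∷ w₂ ∷ a₁ ∷ a₂ ∷ L ∷ I′ ∷ B ∷ [])) ,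
    ≤-by hB (solve (P ∷ w₁ ∷ w₂ ∷ a₁ ∷ a₂ ∷ L ∷ I′ ∷ B ∷ [])) ,
    ≤-by (scale 0≤P² hB ⊕ scale (0≤* 0≤P³-1 0≤P) x>0 ⊕ scale 0≤P³-1 (ℤ.i≤j⇒i-j≤0 I≤B+L))
      (solve (P ∷ w₁ ∷ w₂ ∷ a₁ ∷ a₂ ∷ L ∷ I′ ∷ B ∷ []))
    where
    x>0 : (1ℤ + a₁) - w₁ ℤ.≤ 0ℤ
    x>0 = i<j⇒1+i-j≤0 a₁<w₁

  advance-β∈D : ∀ a₁ a₂ c → ((a₁ + 1ℤ) - a₁ - 1ℤ , (a₂ + c) - a₂ - c) ∈ D⟨ P ⟩
  advance-β∈D a₁ a₂ c =
    ≤-by ℤ.≤-refl (solve (P ∷ a₁ ∷ a₂ ∷ c ∷ [])) , ≤-by ℤ.≤-refl (solve (P ∷ a₁ ∷ a₂ ∷ c ∷ []))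

  advance-β∈Box : ∀ N w₁ w₂ a₁ a₂ L I B → (w₁ , w₂) ∈ Box⟨ N ⟩ → (a₁ , a₂) ∈ Box⟨ N ⟩ →
    a₁ ℤ.< w₁ → I ℤ.≤ B + L → B ℤ.< P → (w₁ , w₂ , L) ≺⟨ P ⟩ (a₁ , a₂ , I) →
    (a₁ + 1ℤ , a₂ + (- (P * P) + P * B)) ∈ Box⟨ N ⟩
  advance-β∈Box N w₁ w₂ a₁ a₂ L I B ((_ , w₁≤N) , (0≤w₂ , _)) ((0≤a₁ , _) , (_ , a₂≤N))
                a₁<w₁ I≤B+L B<P (_ , hB , _) =
    (≤-by (ℤ.i≤j⇒i-j≤0 0≤a₁ ⊕ neg≤0 0≤1) (solve (a₁ ∷ [])) ,
     ≤-by (i<j⇒1+i-j≤0 a₁<w₁ ⊕ ℤ.i≤j⇒i-j≤0 w₁≤N) (solve (N ∷ a₁ ∷ w₁ ∷ []))) ,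
    (≤-by (hB ⊕ scale 0≤P² (i<j⇒1+i-j≤0 a₁<w₁) ⊕ scale 0≤P (ℤ.i≤j⇒i-j≤0 I≤B+L) ⊕ ℤ.i≤j⇒i-j≤0 0≤w₂)
       (solve (P ∷ N ∷ w₁ ∷ w₂ ∷ a₁ ∷ a₂ ∷ L ∷ I ∷ B ∷ [])) ,
     ≤-by (ℤ.i≤j⇒i-j≤0 a₂≤N ⊕ scale 0≤P (i<j⇒1+i-j≤0 B<P) ⊕ neg≤0 0≤P)
       (solve (P ∷ N ∷ a₂ ∷ B ∷ [])))

  -- With fewer than P levels between them, the third inequality of Δ forces w - a to
  -- satisfy the first inequality of D; if moreover w₁ ≤ a₁, the relation survives
  -- lowering a by one level.
  ≺-near-descent : ∀ w₁ w₂ a₁ a₂ L I I′ → I ≡ 1ℤ + I′ → L ℤ.≤ I′ → I ℤ.< P + L →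
    (w₁ , w₂ , L) ≺⟨ P ⟩ (a₁ , a₂ , I) → (w₁ , w₂ , L) ≺⟨ P ⟩ (a₁ , a₂ , I′) ⊎ a₁ ℤ.< w₁
  ≺-near-descent w₁ w₂ a₁ a₂ L _ I′ refl L≤I′ I<P+L (_ , _ , hC) = decide (w₁ ℤ.≤? a₁)
    where
    z : L - I′ ℤ.≤ 0ℤ
    z = ℤ.i≤j⇒i-j≤0 L≤I′
    flat : (w₁ - a₁) + P * (w₂ - a₂) ℤ.≤ 0ℤ
    flat = P*x<P⇒x≤0 (≤-by (hC ⊕ i<j⇒1+i-j≤0 I<P+L) (solve (P ∷ w₁ ∷ w₂ ∷ a₁ ∷ a₂ ∷ L ∷ I′ ∷ [])))
    decide : Dec (w₁ ℤ.≤ a₁) → (w₁ , w₂ , L) ≺⟨ P ⟩ (a₁ , a₂ , I′) ⊎ a₁ ℤ.< w₁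
    decide (no w₁≰a₁) = inj₂ (ℤ.≰⇒> w₁≰a₁)
    decide (yes w₁≤a₁) = inj₁
      (≤-by (flat ⊕ scale 0≤P² z) (solve (P ∷ w₁ ∷ w₂ ∷ a₁ ∷ a₂ ∷ L ∷ I′ ∷ [])) ,
       cancel-P (≤-by (flat ⊕ scale 0≤P³-1 (ℤ.i≤j⇒i-j≤0 w₁≤a₁) ⊕ scale 0≤P² z)
         (solve (P ∷ w₁ ∷ w₂ ∷ a₁ ∷ a₂ ∷ L ∷ I′ ∷ []))) ,
       ≤-by (scale 0≤P flat ⊕ z) (solve (P ∷ w₁ ∷ w₂ ∷ a₁ ∷ a₂ ∷ L ∷ I′ ∷ [])))

¬¬-greatest : (G : ℕ → Set) (m : ℕ) {k : ℕ} → G k → k ≤ m →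
  ¬ ¬ (∃ λ β → G β × (∀ b → G b → b ≤ m → b ≤ β))
¬¬-greatest G zero gk z≤n none = none (zero , gk , λ _ _ b≤0 → b≤0)
¬¬-greatest G (suc m) gk k≤1+m none = ¬¬-greatest G m gk (≤m gk k≤1+m) (none ∘ widen)
  where
  ¬G[1+m] : ¬ G (suc m)
  ¬G[1+m] g = none (suc m , g , λ _ _ b≤1+m → b≤1+m)
  ≤m : ∀ {b} → G b → b ≤ suc m → b ≤ m
  ≤m gb b≤1+m with ℕ.m≤n⇒m<n∨m≡n b≤1+m
  ... | inj₁ b<1+m = ℕ.s≤s⁻¹ b<1+m
  ... | inj₂ refl = ⊥-elim (¬G[1+m] gb)
  widen : (∃ λ β → G β × (∀ b → G b → b ≤ m → b ≤ β)) →
          (∃ λ β → G β × (∀ b → G b → b ≤ suc m → b ≤ β))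
  widen (β , gβ , greatest) = β , gβ , λ b gb b≤1+m → greatest b gb (≤m gb b≤1+m)

+m≡+[m∸n]++n : ∀ {m n} → n ≤ m → + m ≡ + (m ∸ n) + + n
+m≡+[m∸n]++n n≤m = cong +_ (sym (ℕ.m∸n+n≡m n≤m))

≡suc-pred : ∀ {j i} → j < i → i ≡ suc (ℕ.pred i)
≡suc-pred (s≤s _) = refl

module Consistency (p : ℕ) .{{_ : NonZero p}} (n : ℕ) (J : ℕ → Subset2) where

  private
    P : ℤ
    P = + p

    1≤p : 1 ≤ p
    1≤p = ℕ.>-nonZero⁻¹ p

  open Cone P (+≤+ 1≤p)

  IsIdealOfU : Subset2 → Set
  IsIdealOfU S = IsIdeal (λ u v → u ≺₂[ p ] v) (Box n) ⟦ S ⟧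

  ∈Stack : ∀ {m l x y} → l < m → (x , y) ∈ ⟦ J l ⟧ → (x , y , + l) ∈ Stack J m
  ∈Stack l<m h = _ , l<m , refl , h

  Stack⇒level : ∀ {m l x y} → (x , y , + l) ∈ Stack J m → (x , y) ∈ ⟦ J l ⟧
  Stack⇒level {x = x} {y} (_ , _ , l≡j , h) =
    subst (λ k → (x , y) ∈ ⟦ J k ⟧) (sym (ℤ.+-injective l≡j)) h

  Box⇒Prism : ∀ {m l x y} → l < m → (x , y) ∈ Box n → (x , y , + l) ∈ Prism n m
  Box⇒Prism {suc _} (s≤s l≤m) w∈U = w∈U , (+≤+ z≤n , +≤+ l≤m)

  module _ {m : ℕ} (fc : ForwardConsistent p n J m) where

    level⊆U : ∀ {j} → j < m → ⟦ J j ⟧ ⊆ Box n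
    level⊆U j<m a∈ = proj₁ (proj₁ fc (∈Stack j<m a∈))

    level-closed : ∀ {l j w₁ w₂ a₁ a₂} → l < m → j < m → (a₁ , a₂) ∈ ⟦ J j ⟧ →
      (w₁ , w₂) ∈ Box n → (w₁ , w₂ , + l) ≺₃[ p ] (a₁ , a₂ , + j) → (w₁ , w₂) ∈ ⟦ J l ⟧
    level-closed l<m j<m a∈ w∈U w≺a = Stack⇒level (proj₂ fc (∈Stack j<m a∈) (Box⇒Prism l<m w∈U) w≺a)

  consistent⇒conditions : ∀ i → ConsistentWith p n J i → Conditions p n J i
  consistent⇒conditions i cw = condI , condII , condIII , condIV
    where
    top : i < suc i
    top = ℕ.n<1+n i

    below-top : ∀ {k} → i ≡ suc k → k < suc i
    below-top {k} i≡1+k = ℕ.m<n⇒m<1+n (subst (k <_) (sym i≡1+k) (ℕ.n<1+n k))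

    condI : CondI p n J i
    condI k i≡1+k {a₁ , a₂} a∈ = level-closed cw (below-top i≡1+k) top a∈ (level⊆U cw top a∈)
      (≺-pred-level a₁ a₂ (+ i) (+ k) (cong +_ i≡1+k))

    condII : CondII p n J i
    condII k i≡1+k {w₁ , w₂} (((s₁ , s₂) , s∈ , w-s∈D) , w∈U) =
      level-closed cw top (below-top i≡1+k) s∈ w∈U
        (Equivalence.from (≺-up⇔D w₁ w₂ s₁ s₂ (+ i) (+ k) (cong +_ i≡1+k)) w-s∈D)

    condIII : CondIII p n J i
    condIII p≤i {w₁ , w₂} (((s₁ , s₂) , s∈ , w-s∈D) , w∈U) =
      level-closed cw (s≤s (ℕ.m∸n≤m i p)) top s∈ w∈U
        (≺-down⇐D w₁ w₂ s₁ s₂ (+ i) (+ (i ∸ p)) P 0ℤ (+m≡+[m∸n]++n p≤i)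
          (sym (ℤ.+-inverseˡ (P * P))) ℤ.≤-refl w-s∈D)

    condIV : CondIV p n J i
    condIV β ((_ , β≤p-1 , β≤i , _) , _) {w₁ , w₂} (((s₁ , s₂) , s∈ , w-s∈D) , w∈U) =
      level-closed cw (s≤s (ℕ.m∸n≤m i β)) top s∈ w∈U
        (≺-down⇐D w₁ w₂ s₁ s₂ (+ i) (+ (i ∸ β)) (+ β) _ (+m≡+[m∸n]++n β≤i) refl
          (+≤+ (ℕ.≤-trans β≤p-1 (ℕ.m∸n≤m p 1))) w-s∈D)

  module Backward (i : ℕ) (i≤n : i ≤ n) (fc : ForwardConsistent p n J i) (Jᵢ-ideal : IsIdealOfU (J i))
                  (condI : CondI p n J i) (condII : CondII p n J i)
                  (condIII : CondIII p n J i) (condIV : CondIV p n J i) where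

    private
      i′ : ℕ
      i′ = ℕ.pred i

      i′<i : ∀ {j} → j < i → i′ < i
      i′<i j<i = subst (i′ <_) (sym (≡suc-pred j<i)) (ℕ.n<1+n i′)

    ascend : ∀ {j w₁ w₂ a₁ a₂} → j < i → (a₁ , a₂) ∈ ⟦ J j ⟧ → (w₁ , w₂) ∈ Box n →
      (w₁ , w₂ , + i) ≺₃[ p ] (a₁ , a₂ , + j) → (w₁ , w₂) ∈ ⟦ J i ⟧
    ascend {j} {w₁} {w₂} {a₁} {a₂} j<i a∈ w∈U w≺a =
      [ raise-within-U , lift-a ]′ (ℕ.m≤n⇒m<n∨m≡n (ℕ.<⇒≤pred j<i))
      where
      i≡1+i′ : i ≡ suc i′
      i≡1+i′ = ≡suc-pred j<i

      lift : ∀ {s₁ s₂} → (s₁ , s₂) ∈ ⟦ J i′ ⟧ → (w₁ - s₁ - 0ℤ , w₂ - s₂ - - P) ∈ D p →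
             (w₁ , w₂) ∈ ⟦ J i ⟧
      lift s∈ w-s∈D = condII i′ i≡1+i′ ((_ , s∈ , w-s∈D) , w∈U)

      lift-a : j ≡ i′ → (w₁ , w₂) ∈ ⟦ J i ⟧
      lift-a j≡i′ = lift (subst (λ k → (a₁ , a₂) ∈ ⟦ J k ⟧) j≡i′ a∈) (Equivalence.to
        (≺-up⇔D w₁ w₂ a₁ a₂ (+ i) (+ j) (cong +_ (trans i≡1+i′ (cong suc (sym j≡i′))))) w≺a)

      raise-within-U : j < i′ → (w₁ , w₂) ∈ ⟦ J i ⟧
      raise-within-U j<i′ = raise (w₂ + P ℤ.≤? + n)
        where
        +i≡1+i′ : + i ≡ 1ℤ + + i′
        +i≡1+i′ = cong +_ i≡1+i′
        raise : Dec (w₂ + P ℤ.≤ + n) → (w₁ , w₂) ∈ ⟦ J i ⟧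
        raise (yes w₂+P≤n) = lift
          (level-closed fc (i′<i j<i) j<i a∈ (raise-y∈Box (+ n) w₁ w₂ w∈U w₂+P≤n)
            (≺-raise-y w₁ w₂ a₁ a₂ (+ i) (+ i′) (+ j) +i≡1+i′ (+≤+ (ℕ.<⇒≤ j<i′)) w≺a))
          (raise-y∈D w₁ w₂)
        raise (no w₂+P≰n) =
          let w′∈U , w′≺a = ≺-raise-x (+ n) w₁ w₂ a₁ a₂ (+ i) (+ i′) (+ j) +i≡1+i′ (+≤+ j<i′)
                              (ℤ.≰⇒> w₂+P≰n) w∈U (level⊆U fc j<i a∈) w≺a
          in lift (level-closed fc (i′<i j<i) j<i a∈ w′∈U w′≺a) (raise-x∈D w₁ w₂)

    descend-far : ∀ {l w₁ w₂ a₁ a₂} → l < i → p ≤ i ∸ l → (a₁ , a₂) ∈ ⟦ J i ⟧ → (w₁ , w₂) ∈ Box n →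
      (w₁ , w₂ , + l) ≺₃[ p ] (a₁ , a₂ , + i) → (w₁ , w₂) ∈ ⟦ J l ⟧
    descend-far {l} {w₁} {w₂} {a₁} {a₂} l<i p≤i∸l a∈ w∈U w≺a = advance (a₁ + 1ℤ ℤ.≤? + n)
      where
      a∈U : (a₁ , a₂) ∈ Box n
      a∈U = proj₁ Jᵢ-ideal a∈
      p≤i : p ≤ i
      p≤i = ℕ.≤-trans p≤i∸l (ℕ.m∸n≤m i l)
      l≤i∸p : l ≤ i ∸ p
      l≤i∸p = subst (_≤ i ∸ p) (ℕ.m∸[m∸n]≡n (ℕ.<⇒≤ l<i)) (ℕ.∸-monoʳ-≤ i p≤i∸l)

      via-condIII : ∀ {t₁ t₂} → (t₁ , t₂) ∈ Box n → (t₁ - a₁ - 1ℤ , t₂ - a₂ - 0ℤ) ∈ D p →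
        (w₁ , w₂ , + l) ≺₃[ p ] (t₁ , t₂ , + (i ∸ p)) → (w₁ , w₂) ∈ ⟦ J l ⟧
      via-condIII t∈U t-a∈D = level-closed fc l<i (ℕ.∸-monoʳ-< 1≤p p≤i) (condIII p≤i ((_ , a∈ , t-a∈D) , t∈U)) w∈U

      advance : Dec (a₁ + 1ℤ ℤ.≤ + n) → (w₁ , w₂) ∈ ⟦ J l ⟧
      advance (yes a₁+1≤n) =
        via-condIII ((ℤ.≤-trans (proj₁ (proj₁ a∈U)) (ℤ.i≤i+j a₁ 1ℤ) , a₁+1≤n) , proj₂ a∈U)
          (advance-x∈D a₁ a₂) (≺-advance-x w₁ w₂ a₁ a₂ (+ l) (+ i) (+ (i ∸ p)) (+m≡+[m∸n]++n p≤i) (+≤+ l≤i∸p) w≺a)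
      advance (no a₁+1≰n) = decide (w₂ ℤ.≤? a₂)
        where
        n<a₁+1 : + n ℤ.< a₁ + 1ℤ
        n<a₁+1 = ℤ.≰⇒> a₁+1≰n
        decide : Dec (w₂ ℤ.≤ a₂) → (w₁ , w₂) ∈ ⟦ J l ⟧
        decide (yes w₂≤a₂) =
          level-closed fc l<i (i′<i l<i) (condI i′ (≡suc-pred l<i) a∈) w∈U
            (≺-of-nonpositive w₁ w₂ a₁ a₂ (+ l) (+ i′) (ℤ.≤-trans (proj₂ (proj₁ w∈U)) (i<j+1⇒i≤j n<a₁+1))
              w₂≤a₂ (+≤+ (ℕ.<⇒≤pred l<i)))
        decide (no w₂≰a₂) =
          via-condIII
            (advance-xy∈Box (+ n) w₁ w₂ a₁ a₂ w∈U a∈U n<a₁+1 (+≤+ (ℕ.≤-trans p≤i i≤n)) (ℤ.≰⇒> w₂≰a₂))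
            (advance-xy∈D a₁ a₂)
            (≺-advance-xy w₁ w₂ a₁ a₂ (+ l) (+ i) (+ (i ∸ p)) (+m≡+[m∸n]++n p≤i) (+≤+ l≤i∸p) (ℤ.≰⇒> w₂≰a₂) w≺a)

    descend-via-largest : ∀ {l β w₁ w₂ a₁ a₂} → l < i → IsLargestGoodBeta p n J i β → i ≤ β ℕ.+ l →
      a₁ ℤ.< w₁ → (a₁ , a₂) ∈ ⟦ J i ⟧ → (w₁ , w₂) ∈ Box n →
      (w₁ , w₂ , + l) ≺₃[ p ] (a₁ , a₂ , + i) → (w₁ , w₂) ∈ ⟦ J l ⟧
    descend-via-largest {l} {β} {w₁} {w₂} {a₁} {a₂} l<i largest@((1≤β , β≤p-1 , β≤i , _) , _)
                        i≤β+l a₁<w₁ a∈ w∈U w≺a =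
      level-closed fc l<i (ℕ.∸-monoʳ-< 1≤β β≤i) (condIV β largest ((_ , a∈ , advance-β∈D a₁ a₂ _) , t∈U)) w∈U w≺t
      where
      β<p : β < p
      β<p = ℕ.≤-<-trans β≤p-1 (ℕ.∸-monoʳ-< (s≤s z≤n) 1≤p)
      t∈U : (a₁ + 1ℤ , a₂ + (- (P * P) + P * + β)) ∈ Box n
      t∈U = advance-β∈Box (+ n) w₁ w₂ a₁ a₂ (+ l) (+ i) (+ β) w∈U (proj₁ Jᵢ-ideal a∈) a₁<w₁
              (+≤+ i≤β+l) (+<+ β<p) w≺a
      w≺t : (w₁ , w₂ , + l) ≺₃[ p ] (a₁ + 1ℤ , a₂ + (- (P * P) + P * + β) , + (i ∸ β))
      w≺t = ≺-advance-β w₁ w₂ a₁ a₂ (+ l) (+ i) (+ (i ∸ β)) (+ β) (+m≡+[m∸n]++n β≤i)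
              a₁<w₁ (+≤+ i≤β+l) w≺a

    descend-near : ∀ {l w₁ w₂ a₁ a₂} → l < i → i ∸ l < p → (a₁ , a₂) ∈ ⟦ J i ⟧ → (w₁ , w₂) ∈ Box n →
      (w₁ , w₂ , + l) ≺₃[ p ] (a₁ , a₂ , + i) → (w₁ , w₂) ∈ ⟦ J l ⟧
    descend-near {l} {w₁} {w₂} {a₁} {a₂} l<i i∸l<p a∈ w∈U w≺a =
      [ level-closed fc l<i (i′<i l<i) (condI i′ i≡1+i′ a∈) w∈U , via-largest ]′
        (≺-near-descent w₁ w₂ a₁ a₂ (+ l) (+ i) (+ i′) (cong +_ i≡1+i′) (+≤+ (ℕ.<⇒≤pred l<i)) (+<+ i<p+l) w≺a)
      where
      l≤i : l ≤ i
      l≤i = ℕ.<⇒≤ l<i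
      i≡1+i′ : i ≡ suc i′
      i≡1+i′ = ≡suc-pred l<i
      i<p+l : i < p ℕ.+ l
      i<p+l = subst (_< p ℕ.+ l) (ℕ.m∸n+n≡m l≤i) (ℕ.+-monoˡ-< l i∸l<p)

      i∸l-good : ¬ (w₁ , w₂) ∈ ⟦ J l ⟧ → GoodBeta p n J i (i ∸ l)
      i∸l-good w∉Jₗ = ℕ.m<n⇒0<n∸m l<i , ℕ.∸-monoˡ-≤ 1 i∸l<p , ℕ.m∸n≤m i l ,
        λ Jᵢ₋ₖ≐U → w∉Jₗ (subst (λ k → (w₁ , w₂) ∈ ⟦ J k ⟧) (ℕ.m∸[m∸n]≡n l≤i) (proj₂ Jᵢ₋ₖ≐U w∈U))

      -- Membership of a lattice point is decidable, so the largest admissible β only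
      -- needs to exist up to double negation.
      via-largest : a₁ ℤ.< w₁ → (w₁ , w₂) ∈ ⟦ J l ⟧
      via-largest a₁<w₁ = decidable-stable (J l (w₁ , w₂) Bool.≟ true) λ w∉Jₗ →
        ¬¬-greatest (GoodBeta p n J i) (p ∸ 1) (i∸l-good w∉Jₗ) (ℕ.∸-monoˡ-≤ 1 i∸l<p)
          λ (β , good , greatest) →
            let i∸l≤β = greatest (i ∸ l) (i∸l-good w∉Jₗ) (ℕ.∸-monoˡ-≤ 1 i∸l<p) in
            w∉Jₗ (descend-via-largest l<i (good , λ b gb → greatest b gb (proj₁ (proj₂ gb)))
                   (subst (_≤ β ℕ.+ l) (ℕ.m∸n+n≡m l≤i) (ℕ.+-monoˡ-≤ l i∸l≤β)) a₁<w₁ a∈ w∈U w≺a)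

    descend : ∀ {l w₁ w₂ a₁ a₂} → l < i → (a₁ , a₂) ∈ ⟦ J i ⟧ → (w₁ , w₂) ∈ Box n →
      (w₁ , w₂ , + l) ≺₃[ p ] (a₁ , a₂ , + i) → (w₁ , w₂) ∈ ⟦ J l ⟧
    descend {l} l<i with p ℕ.≤? i ∸ l
    ... | yes p≤i∸l = descend-far l<i p≤i∸l
    ... | no p≰i∸l = descend-near l<i (ℕ.≰⇒> p≰i∸l)

    closed-at : ∀ {l j w₁ w₂ a₁ a₂} → l ≤ i → j ≤ i → (a₁ , a₂) ∈ ⟦ J j ⟧ → (w₁ , w₂) ∈ Box n →
      (w₁ , w₂ , + l) ≺₃[ p ] (a₁ , a₂ , + j) → (w₁ , w₂) ∈ ⟦ J l ⟧
    closed-at {w₁ = w₁} {w₂} {a₁} {a₂} l≤i j≤i with ℕ.m≤n⇒m<n∨m≡n l≤i | ℕ.m≤n⇒m<n∨m≡n j≤i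
    ... | inj₁ l<i  | inj₁ j<i  = level-closed fc l<i j<i
    ... | inj₂ refl | inj₁ j<i  = ascend j<i
    ... | inj₁ l<i  | inj₂ refl = descend l<i
    ... | inj₂ refl | inj₂ refl = λ a∈ w∈U w≺a →
      proj₂ Jᵢ-ideal a∈ w∈U (≺-same-level⇒D w₁ w₂ a₁ a₂ (+ i) w≺a)

    consistent : ConsistentWith p n J i
    consistent = stack⊆prism , closed
      where
      level⊆U′ : ∀ {j} → j < suc i → ⟦ J j ⟧ ⊆ Box n
      level⊆U′ j<1+i with ℕ.m≤n⇒m<n∨m≡n (ℕ.s≤s⁻¹ j<1+i)
      ... | inj₁ j<i = level⊆U fc j<i
      ... | inj₂ refl = proj₁ Jᵢ-ideal

      stack⊆prism : Stack J (suc i) ⊆ Prism n (suc i)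
      stack⊆prism {_ , _ , _} (_ , j<1+i , refl , a∈) = Box⇒Prism j<1+i (level⊆U′ j<1+i a∈)

      closed : ∀ {u v} → u ∈ Stack J (suc i) → v ∈ Prism n (suc i) → v ≺₃[ p ] u → v ∈ Stack J (suc i)
      closed {_ , _ , _} {_ , _ , _} (_ , j<1+i , refl , a∈) (w∈U , (+≤+ {n = l} _ , +≤+ l≤i)) w≺a =
        ∈Stack (s≤s l≤i) (closed-at l≤i (ℕ.s≤s⁻¹ j<1+i) a∈ w∈U w≺a)

-- The ideals J₀, …, J_{i-1} are already
-- ideals of U by forward consistency.
theorem4p6 : (p m : ℕ) → Prime p → 0 < m → 3 ∣ m →
    (J : ℕ → Subset2) (i : ℕ) → i ≤ nOf m p →
    (∀ j → j < i → IsIdeal (λ u v → u ≺₂[ p ] v) (Box (nOf m p)) ⟦ J j ⟧) →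
    ForwardConsistent p (nOf m p) J i →
    IsIdeal (λ u v → u ≺₂[ p ] v) (Box (nOf m p)) ⟦ J i ⟧ →
    (ConsistentWith p (nOf m p) J i ⇔ Conditions p (nOf m p) J i)
theorem4p6 p m p-prime _ _ J i i≤n _ fc Jᵢ-ideal =
  mk⇔ (consistent⇒conditions i)
      (λ (condI , condII , condIII , condIV) →
        Backward.consistent i i≤n fc Jᵢ-ideal condI condII condIII condIV)
  where open Consistency p {{prime⇒nonZero p-prime}} (nOf m p) J
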